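{- For all integers $e,n\ge 1$ and every positive divisor $d$ of $e$, there exists a cyclic $S_{e+1}$-decomposition of the complete multipartite graph $K_{(\frac{e}{d}+1)\times 2dn}$, where $S_{e+1}$ is the star with $e$ edges.
   Context: The star $S_{e+1}$ is the complete bipartite graph $K_{1,e}$. $K_{a\times b}$ denotes the complete $a$-partite graph with $a$ parts each of size $b$. For a graph $\Gamma$, a $\Gamma$-decomposition of a graph $K$ is a set of subgraphs of $K$ each isomorphic to $\Gamma$ whose edge sets partition $E(K)$; it is cyclic if some bijection of $V(K)$ that is a single cycle of length $|V(K)|$ maps the set of blocks onto itself. -}

module Defs where

open import Data.Nat using (ℕ; _*_)
open import Data.Fin using (Fin)
open import Data.Product using (Σ; ∃; _×_; _,_; proj₁)
open import Data.Sum using (_⊎_)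
open import Function using (_↔_; Inverse)
open import Function.Definitions using (Injective)
open import Relation.Binary.PropositionalEquality using (_≡_; _≢_)
open import Relation.Nullary using (¬_)
open import Data.Nat.GeneralisedArithmetic using (iterate)

-- Complete multipartite graph K_{a × b}: vertices are pairs (part, index),
-- two vertices adjacent iff they lie in different parts.
Vtx : ℕ → ℕ → Set
Vtx a b = Fin a × Fin b

Adj : {a b : ℕ} → Vtx a b → Vtx a b → Set
Adj u v = proj₁ u ≢ proj₁ v

record Star (e a b : ℕ) : Set where
  field
    centre   : Vtx a b
    leaf     : Fin e → Vtx a b
    leafInj  : Injective _≡_ _≡_ leaf
    leafAdj  : ∀ k → Adj centre (leaf k)
open Star public

EdgeOf : {e a b : ℕ} → Star e a b → Vtx a b → Vtx a b → Set
EdgeOf S u v =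
  (u ≡ centre S × ∃ λ k → leaf S k ≡ v) ⊎ (v ≡ centre S × ∃ λ k → leaf S k ≡ u)

IsStarDecomposition : (e a b m : ℕ) → (Fin m → Star e a b) → Set
IsStarDecomposition e a b m B =
  ∀ (u v : Vtx a b) → Adj u v →
    ∃ λ i → EdgeOf (B i) u v × (∀ j → EdgeOf (B j) u v → j ≡ i)

IsFullCycle : {a b : ℕ} → (Vtx a b ↔ Vtx a b) → Set
IsFullCycle {a} {b} σ =
  ∃ λ (v₀ : Vtx a b) → ∀ w → ∃ λ (k : ℕ) → iterate (Inverse.to σ) v₀ k ≡ w

-- σ maps the set of blocks onto itself: the image of each block's edge set
-- under σ is the edge set of some block (surjectivity onto the finite
-- family then follows from injectivity of σ).
MapsBlocks : {e a b m : ℕ} → (Vtx a b ↔ Vtx a b) → (Fin m → Star e a b) → Set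
MapsBlocks σ B =
  ∀ i → ∃ λ j → ∀ u v →
    (EdgeOf (B i) u v → EdgeOf (B j) (Inverse.to σ u) (Inverse.to σ v)) ×
    (EdgeOf (B j) (Inverse.to σ u) (Inverse.to σ v) → EdgeOf (B i) u v)

HasCyclicStarDecomposition : (e a b : ℕ) → Set
HasCyclicStarDecomposition e a b =
  Σ ℕ λ m → Σ (Fin m → Star e a b) λ B →
    IsStarDecomposition e a b m B ×
    (∃ λ (σ : Vtx a b ↔ Vtx a b) → IsFullCycle σ × MapsBlocks σ B)

module Submission where

-- Proof idea (a "half difference set" construction).  Number the vertices of
-- K_{M × L} (M = q + 1 parts of size L = 2dn) by the residues modulo N = L·M,
-- so that the part of a vertex is its residue modulo M; two vertices are then
-- adjacent iff their difference is not divisible by M.  Put H = N / 2 = dn·M.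
-- The admissible offsets z with 0 < z < H and M ∤ z are exactly dn·q = n·e
-- numbers; split them into n classes of e offsets each.  For every vertex u
-- and every class t, the star centred at u with leaves u + (offsets of t) is
-- a block.  Since H ≡ 0 (mod M), for an edge {u,v} exactly one of the two
-- differences v - u, u - v lies in (0, H), so every edge lies in exactly one
-- block; and the rotation u ↦ u + 1, a single cycle on all N vertices, maps
-- the star at (u, t) to the star at (u + 1, t).

open import Defs
open import Data.Nat using (ℕ; zero; suc; _≤_; _<_; _+_; _*_; _∸_; _%_; _/_; _<?_; NonZero; >-nonZero⁻¹)
open import Data.Nat.Properties
open import Data.Nat.DivMod
open import Data.Nat.Solver using (module +-*-Solver)
open import Data.Nat.Divisibility using (_∣_; divides; n∣m*n; m∣m*n)
open import Data.Fin as Fin using (Fin; toℕ; fromℕ<; combine; remQuot)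
open import Data.Fin.Properties
  using (toℕ-combine; combine-remQuot; remQuot-combine; combine-injective; combine-surjective; toℕ-fromℕ<; fromℕ<-cong; toℕ<n; toℕ-injective; *↔×)
  renaming (suc-injective to Fin-suc-injective)
open import Data.Product using (∃; ∃₂; _×_; _,_; proj₁; proj₂; swap; uncurry)
open import Data.Product.Function.NonDependent.Propositional using (_×-↔_)
open import Data.Sum using (_⊎_; inj₁; inj₂)
import Data.Sum as Sum
open import Data.Empty using (⊥; ⊥-elim)
open import Relation.Binary.PropositionalEquality
open import Relation.Nullary using (yes; no)
open import Function using (_↔_; Inverse; _∘_)
open import Function.Bundles using (mk↔ₛ′)
open import Function.Properties.Inverse using (↔-trans; ↔-refl)
open import Data.Nat.GeneralisedArithmetic using (iterate)

-- Residue arithmetic on ℕ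

%-absorbˡ : ∀ K .{{_ : NonZero K}} a b → (a % K + b) % K ≡ (a + b) % K
%-absorbˡ K a b = begin
  (a % K + b) % K          ≡⟨ %-distribˡ-+ (a % K) b K ⟩
  (a % K % K + b % K) % K  ≡⟨ cong (λ x → (x + b % K) % K) (m%n%n≡m%n a K) ⟩
  (a % K + b % K) % K      ≡⟨ %-distribˡ-+ a b K ⟨
  (a + b) % K              ∎
  where open ≡-Reasoning

%-absorbʳ : ∀ K .{{_ : NonZero K}} a b → (a + b % K) % K ≡ (a + b) % K
%-absorbʳ K a b = begin
  (a + b % K) % K  ≡⟨ cong (_% K) (+-comm a (b % K)) ⟩
  (b % K + a) % K  ≡⟨ %-absorbˡ K b a ⟩
  (b + a) % K      ≡⟨ cong (_% K) (+-comm b a) ⟩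
  (a + b) % K      ∎
  where open ≡-Reasoning

-- Addition is cancellative on residues: adding c = K ∸ a % K turns a into a
-- multiple of K, which undoes the common summand a.
+-cancelˡ-% : ∀ K .{{_ : NonZero K}} a δ δ′ →
              (a + δ) % K ≡ (a + δ′) % K → δ % K ≡ δ′ % K
+-cancelˡ-% K a δ δ′ eq = begin
  δ % K                   ≡⟨ %-remove-+ʳ δ K∣a+c ⟨
  (δ + (a + c)) % K       ≡⟨ cong (_% K) (shuffle δ) ⟩
  (a + δ + c) % K         ≡⟨ %-absorbˡ K (a + δ) c ⟨
  ((a + δ) % K + c) % K   ≡⟨ cong (λ x → (x + c) % K) eq ⟩
  ((a + δ′) % K + c) % K  ≡⟨ %-absorbˡ K (a + δ′) c ⟩
  (a + δ′ + c) % K        ≡⟨ cong (_% K) (shuffle δ′) ⟨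
  (δ′ + (a + c)) % K      ≡⟨ %-remove-+ʳ δ′ K∣a+c ⟩
  δ′ % K                  ∎
  where
  open ≡-Reasoning
  c = K ∸ a % K
  r = a % K
  s = a / K * K
  K∣a+c : K ∣ a + c
  K∣a+c = divides (suc (a / K)) (begin
    a + c        ≡⟨ cong (_+ c) (m≡m%n+[m/n]*n a K) ⟩
    r + s + c    ≡⟨ cong (_+ c) (+-comm r s) ⟩
    s + r + c    ≡⟨ +-assoc s r c ⟩
    s + (r + c)  ≡⟨ cong (s +_) (m+[n∸m]≡n (m%n≤n a K)) ⟩
    s + K        ≡⟨ +-comm s K ⟩
    K + s        ∎)
  shuffle : ∀ x → x + (a + c) ≡ a + x + c
  shuffle x = trans (sym (+-assoc x a c)) (cong (_+ c) (+-comm x a))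

0%n≡0 : ∀ K .{{_ : NonZero K}} → 0 % K ≡ 0
0%n≡0 (suc k) = refl

multiple-below-double : ∀ N .{{_ : NonZero N}} z →
                        z % N ≡ 0 → 0 < z → z < N + N → z ≡ N
multiple-below-double N z z%N≡0 0<z z<2N with z / N | m≡m%n+[m/n]*n z N
... | zero        | z≡ = ⊥-elim (<-irrefl (sym (trans z≡ (cong (_+ 0) z%N≡0))) 0<z)
... | suc zero    | z≡ = trans z≡ (trans (cong (_+ (N + 0)) z%N≡0) (+-identityʳ N))
... | suc (suc k) | z≡ = ⊥-elim (<⇒≱ z<2N 2N≤z)
  where
  2N≤z : N + N ≤ z
  2N≤z = ≤-trans (+-monoʳ-≤ N (m≤m+n N (k * N)))
                 (≤-reflexive (sym (trans z≡ (cong (_+ (N + (N + k * N))) z%N≡0))))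

toℕ-combine-% : ∀ {X M} .{{_ : NonZero M}} (j : Fin X) (p : Fin M) →
                toℕ (combine j p) % M ≡ toℕ p
toℕ-combine-% {M = M} j p = begin
  toℕ (combine j p) % M      ≡⟨ cong (_% M) (toℕ-combine j p) ⟩
  (M * toℕ j + toℕ p) % M    ≡⟨ %-remove-+ˡ (toℕ p) (m∣m*n (toℕ j)) ⟩
  toℕ p % M                  ≡⟨ m<n⇒m%n≡m (toℕ<n p) ⟩
  toℕ p                      ∎
  where open ≡-Reasoning

-- The rotation of K_{M × L}.  Vertex (p , j) is numbered M·j + p < N = L·M,
-- so vertices are residues modulo N whose part is the residue modulo M;
-- `shift a` adds a to every vertex number.
module Rotation (M L : ℕ) {{_ : NonZero M}} {{_ : NonZero (L * M)}} where

  N : ℕ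
  N = L * M

  V : Set
  V = Vtx M L

  enc : V → ℕ
  enc (p , j) = toℕ (combine j p)

  enc<N : ∀ u → enc u < N
  enc<N (p , j) = toℕ<n (combine j p)

  dec : ℕ → V
  dec z = swap (remQuot {L} M (fromℕ< (m%n<n z N)))

  enc-dec : ∀ z → enc (dec z) ≡ z % N
  enc-dec z = trans (cong toℕ (combine-remQuot {L} M (fromℕ< (m%n<n z N))))
                    (toℕ-fromℕ< (m%n<n z N))

  dec-enc : ∀ u → dec (enc u) ≡ u
  dec-enc (p , j) = trans (cong (λ x → swap (remQuot M x)) fromℕ<-enc)
                          (cong swap (remQuot-combine j p))
    where
    fromℕ<-enc : fromℕ< (m%n<n (enc (p , j)) N) ≡ combine j p
    fromℕ<-enc = toℕ-injective (trans (toℕ-fromℕ< _) (m<n⇒m%n≡m (enc<N (p , j))))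

  dec-cong : ∀ z z′ → z % N ≡ z′ % N → dec z ≡ dec z′
  dec-cong z z′ eq = cong (λ x → swap (remQuot M x)) (fromℕ<-cong _ _ eq _ _)

  part-enc : ∀ u → toℕ (proj₁ u) ≡ enc u % M
  part-enc (p , j) = sym (toℕ-combine-% j p)

  shift : ℕ → V → V
  shift a u = dec (enc u + a)

  enc-shift : ∀ a u → enc (shift a u) ≡ (enc u + a) % N
  enc-shift a u = enc-dec (enc u + a)

  part-shift : ∀ a u → toℕ (proj₁ (shift a u)) ≡ (enc u + a) % M
  part-shift a u = begin
    toℕ (proj₁ (shift a u))  ≡⟨ part-enc (shift a u) ⟩
    enc (shift a u) % M      ≡⟨ cong (_% M) (enc-shift a u) ⟩
    (enc u + a) % N % M      ≡⟨ m∣n⇒o%n%m≡o%m M N (enc u + a) (n∣m*n L) ⟩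
    (enc u + a) % M          ∎
    where open ≡-Reasoning

  shift-same-part⇒ : ∀ a u → proj₁ (shift a u) ≡ proj₁ u → a % M ≡ 0
  shift-same-part⇒ a u eq = trans (+-cancelˡ-% M (enc u) a 0 (begin
    (enc u + a) % M          ≡⟨ part-shift a u ⟨
    toℕ (proj₁ (shift a u))  ≡⟨ cong toℕ eq ⟩
    toℕ (proj₁ u)            ≡⟨ part-enc u ⟩
    enc u % M                ≡⟨ cong (_% M) (+-identityʳ (enc u)) ⟨
    (enc u + 0) % M          ∎)) (0%n≡0 M)
    where open ≡-Reasoning

  shift-same-part⇐ : ∀ a u → a % M ≡ 0 → proj₁ (shift a u) ≡ proj₁ u
  shift-same-part⇐ a u a%M≡0 = toℕ-injective (begin
    toℕ (proj₁ (shift a u))  ≡⟨ part-shift a u ⟩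
    (enc u + a) % M          ≡⟨ %-absorbʳ M (enc u) a ⟨
    (enc u + a % M) % M      ≡⟨ cong (λ x → (enc u + x) % M) a%M≡0 ⟩
    (enc u + 0) % M          ≡⟨ cong (_% M) (+-identityʳ (enc u)) ⟩
    enc u % M                ≡⟨ part-enc u ⟨
    toℕ (proj₁ u)            ∎)
    where open ≡-Reasoning

  shift-shift : ∀ a b u → shift a (shift b u) ≡ shift (b + a) u
  shift-shift a b u = dec-cong _ _ (begin
    (enc (shift b u) + a) % N    ≡⟨ cong (λ x → (x + a) % N) (enc-shift b u) ⟩
    ((enc u + b) % N + a) % N    ≡⟨ %-absorbˡ N (enc u + b) a ⟩
    (enc u + b + a) % N          ≡⟨ cong (_% N) (+-assoc (enc u) b a) ⟩
    (enc u + (b + a)) % N        ∎)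
    where open ≡-Reasoning

  shift-0 : ∀ u → shift 0 u ≡ u
  shift-0 u = trans (cong dec (+-identityʳ (enc u))) (dec-enc u)

  shift-N : ∀ u → shift N u ≡ u
  shift-N u = trans (dec-cong _ _ ([m+n]%n≡m%n (enc u) N)) (dec-enc u)

  shift-injective : ∀ {a b u} → shift a u ≡ shift b u → a < N → b < N → a ≡ b
  shift-injective {a} {b} {u} eq a<N b<N = begin
    a      ≡⟨ m<n⇒m%n≡m a<N ⟨
    a % N  ≡⟨ +-cancelˡ-% N (enc u) a b same-residue ⟩
    b % N  ≡⟨ m<n⇒m%n≡m b<N ⟩
    b      ∎
    where
    open ≡-Reasoning
    same-residue : (enc u + a) % N ≡ (enc u + b) % N
    same-residue = trans (sym (enc-shift a u)) (trans (cong enc eq) (enc-shift b u))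

  diff : V → V → ℕ
  diff u v = (enc v + (N ∸ enc u)) % N

  diff<N : ∀ u v → diff u v < N
  diff<N u v = m%n<n _ N

  shift-diff : ∀ u v → shift (diff u v) u ≡ v
  shift-diff u v = trans (dec-cong _ (enc v) residue) (dec-enc v)
    where
    open ≡-Reasoning
    residue : (enc u + diff u v) % N ≡ enc v % N
    residue = begin
      (enc u + diff u v) % N                ≡⟨ %-absorbʳ N (enc u) _ ⟩
      (enc u + (enc v + (N ∸ enc u))) % N   ≡⟨ cong (_% N) (+-assoc (enc u) (enc v) _) ⟨
      (enc u + enc v + (N ∸ enc u)) % N     ≡⟨ cong (λ x → (x + (N ∸ enc u)) % N) (+-comm (enc u) (enc v)) ⟩
      (enc v + enc u + (N ∸ enc u)) % N     ≡⟨ cong (_% N) (+-assoc (enc v) (enc u) _) ⟩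
      (enc v + (enc u + (N ∸ enc u))) % N   ≡⟨ cong (λ x → (enc v + x) % N) (m+[n∸m]≡n (<⇒≤ (enc<N u))) ⟩
      (enc v + N) % N                       ≡⟨ [m+n]%n≡m%n (enc v) N ⟩
      enc v % N                             ∎

  diff-adjacent : ∀ u v → Adj u v → diff u v % M ≢ 0
  diff-adjacent u v adj d%M≡0 =
    adj (sym (trans (sym (cong proj₁ (shift-diff u v))) (shift-same-part⇐ (diff u v) u d%M≡0)))

  diff-sum : ∀ u v → Adj u v → diff u v + diff v u ≡ N
  diff-sum u v adj =
    multiple-below-double N (δ + δ′) residue-0 0<δ+δ′ (+-mono-< (diff<N u v) (diff<N v u))
    where
    δ = diff u v
    δ′ = diff v u
    round-trip : shift (δ + δ′) u ≡ shift 0 u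
    round-trip = trans (sym (shift-shift δ′ δ u))
                   (trans (cong (shift δ′) (shift-diff u v)) (trans (shift-diff v u) (sym (shift-0 u))))
    residue-0 : (δ + δ′) % N ≡ 0
    residue-0 = trans (+-cancelˡ-% N (enc u) _ _ (trans (sym (enc-shift _ u)) (trans (cong enc round-trip) (enc-shift 0 u))))
                      (0%n≡0 N)
    0<δ+δ′ : 0 < δ + δ′
    0<δ+δ′ = <-≤-trans (n≢0⇒n>0 (λ δ≡0 → diff-adjacent u v adj (trans (cong (_% M) δ≡0) (0%n≡0 M)))) (m≤m+n δ δ′)

  rotate : V → V
  rotate = shift 1

  ρ : V ↔ V
  ρ = mk↔ₛ′ rotate (shift (N ∸ 1)) rotate-unrotate unrotate-rotate
    where
    N∸1+1 : N ∸ 1 + 1 ≡ N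
    N∸1+1 = m∸n+n≡m (>-nonZero⁻¹ N)
    rotate-unrotate : ∀ u → rotate (shift (N ∸ 1) u) ≡ u
    rotate-unrotate u = trans (shift-shift 1 (N ∸ 1) u) (trans (cong (λ x → shift x u) N∸1+1) (shift-N u))
    unrotate-rotate : ∀ u → shift (N ∸ 1) (rotate u) ≡ u
    unrotate-rotate u = trans (shift-shift (N ∸ 1) 1 u)
                          (trans (cong (λ x → shift x u) (trans (+-comm 1 (N ∸ 1)) N∸1+1)) (shift-N u))

  rotate-injective : ∀ {u v} → rotate u ≡ rotate v → u ≡ v
  rotate-injective {u} {v} eq = trans (sym (Inverse.strictlyInverseʳ ρ u))
                                  (trans (cong (Inverse.from ρ) eq) (Inverse.strictlyInverseʳ ρ v))

  iterate-rotate : ∀ a k → iterate rotate (dec a) k ≡ dec (a + k)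
  iterate-rotate a zero = cong dec (sym (+-identityʳ a))
  iterate-rotate a (suc k) = begin
    iterate rotate (rotate (dec a)) k  ≡⟨ cong (λ u → iterate rotate u k) rotate-dec ⟩
    iterate rotate (dec (a + 1)) k     ≡⟨ iterate-rotate (a + 1) k ⟩
    dec (a + 1 + k)                    ≡⟨ cong dec (+-assoc a 1 k) ⟩
    dec (a + suc k)                    ∎
    where
    open ≡-Reasoning
    rotate-dec : rotate (dec a) ≡ dec (a + 1)
    rotate-dec = dec-cong _ _ (trans (cong (λ x → (x + 1) % N) (enc-dec a)) (%-absorbˡ N a 1))

  ρ-full-cycle : IsFullCycle ρ
  ρ-full-cycle = dec 0 , λ w → enc w , trans (iterate-rotate 0 (enc w)) (dec-enc w)

  shift-rotate : ∀ a u → shift a (rotate u) ≡ rotate (shift a u)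
  shift-rotate a u = trans (shift-shift a 1 u)
                       (trans (cong (λ x → shift x u) (+-comm 1 a)) (sym (shift-shift 1 a u)))

-- Star families indexed by an arbitrary finite type.  The definitions of
-- Defs index blocks by Fin m; these are the same notions for any index type.
module _ {e a b : ℕ} where

  PartitionsEdges : {I : Set} → (I → Star e a b) → Set
  PartitionsEdges S =
    ∀ u v → Adj u v → ∃ λ i → EdgeOf (S i) u v × (∀ j → EdgeOf (S j) u v → j ≡ i)

  PermutesStars : {I : Set} → (Vtx a b ↔ Vtx a b) → (I → Star e a b) → Set
  PermutesStars σ S = ∀ i → ∃ λ j → ∀ u v →
    (EdgeOf (S i) u v → EdgeOf (S j) (Inverse.to σ u) (Inverse.to σ v)) ×
    (EdgeOf (S j) (Inverse.to σ u) (Inverse.to σ v) → EdgeOf (S i) u v)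

  cyclic-decomposition : ∀ {I : Set} m → Fin m ↔ I → (S : I → Star e a b) →
    PartitionsEdges S → (σ : Vtx a b ↔ Vtx a b) → IsFullCycle σ → PermutesStars σ S →
    HasCyclicStarDecomposition e a b
  cyclic-decomposition {I} m ι S partition σ full-cycle permutes =
    m , B , decomposition , σ , full-cycle , maps-blocks
    where
    open Inverse ι using (to; from; strictlyInverseˡ; strictlyInverseʳ)
    B : Fin m → Star e a b
    B i = S (to i)
    B-from : ∀ i → B (from i) ≡ S i
    B-from i = cong S (strictlyInverseˡ i)
    decomposition : IsStarDecomposition e a b m B
    decomposition u v adj with partition u v adj
    ... | i , edge , unique =
      from i , subst (λ T → EdgeOf T u v) (sym (B-from i)) edge ,
      λ j edgeʲ → trans (sym (strictlyInverseʳ j)) (cong from (unique (to j) edgeʲ))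
    maps-blocks : MapsBlocks σ B
    maps-blocks i with permutes (to i)
    ... | j , maps = from j , λ u v →
      subst (λ T → (EdgeOf (B i) u v → EdgeOf T (Inverse.to σ u) (Inverse.to σ v)) ×
                   (EdgeOf T (Inverse.to σ u) (Inverse.to σ v) → EdgeOf (B i) u v))
            (sym (B-from j)) (maps u v)

module OffsetStars (M L H : ℕ) {{_ : NonZero M}} {{_ : NonZero (L * M)}}
    (N≡H+H : L * M ≡ H + H) (H%M≡0 : H % M ≡ 0)
    (n e : ℕ) (off : Fin n → Fin e → ℕ)
    (off<H : ∀ t k → off t k < H)
    (off-admissible : ∀ t k → off t k % M ≢ 0)
    (off-injective : ∀ {t k t′ k′} → off t k ≡ off t′ k′ → t ≡ t′ × k ≡ k′)
    (off-covers : ∀ z → z < H → z % M ≢ 0 → ∃₂ λ t k → off t k ≡ z)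
  where

  open Rotation M L

  H<N : ∀ {z} → z < H → z < N
  H<N z<H = <-≤-trans z<H (≤-trans (m≤m+n H H) (≤-reflexive (sym N≡H+H)))

  off-positive : ∀ t k → 0 < off t k
  off-positive t k = n≢0⇒n>0 (λ off≡0 → off-admissible t k (trans (cong (_% M) off≡0) (0%n≡0 M)))

  star : V × Fin n → Star e M L
  star (u , t) = record
    { centre  = u
    ; leaf    = λ k → shift (off t k) u
    ; leafInj = λ {k} {k′} eq →
        proj₂ (off-injective (shift-injective eq (H<N (off<H t k)) (H<N (off<H t k′))))
    ; leafAdj = λ k same → off-admissible t k (shift-same-part⇒ (off t k) u (sym same))
    }

  Leaf : V → V → Set
  Leaf u v = ∃₂ λ t k → shift (off t k) u ≡ v

  leaf-by-diff : ∀ u v → (∃₂ λ t k → off t k ≡ diff u v) → Leaf u v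
  leaf-by-diff u v (t , k , eq) = t , k , trans (cong (λ a → shift a u) eq) (shift-diff u v)

  -- Two shifts below H never undo each other: their sum would be a
  -- multiple of N strictly between 0 and N.
  no-mutual-shifts : ∀ {a b u v} → shift a u ≡ v → shift b v ≡ u → 0 < a → a < H → b < H → ⊥
  no-mutual-shifts {a} {b} {u} {v} a-step b-step 0<a a<H b<H =
    <-irrefl (sym a+b≡0) (<-≤-trans 0<a (m≤m+n a b))
    where
    round-trip : shift (a + b) u ≡ shift 0 u
    round-trip = trans (sym (shift-shift b a u))
                   (trans (cong (shift b) a-step) (trans b-step (sym (shift-0 u))))
    a+b<N : a + b < N
    a+b<N = <-≤-trans (+-mono-< a<H b<H) (≤-reflexive (sym N≡H+H))
    a+b≡0 : a + b ≡ 0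
    a+b≡0 = shift-injective round-trip a+b<N (>-nonZero⁻¹ N)

  -- Every edge is covered from one of its ends: of the two differences,
  -- which add up to H + H, one is below H (neither equals H, as M ∣ H).
  edge-covered : ∀ u v → Adj u v → Leaf u v ⊎ Leaf v u
  edge-covered u v adj with diff u v <? H
  ... | yes δ<H = inj₁ (leaf-by-diff u v (off-covers (diff u v) δ<H (diff-adjacent u v adj)))
  ... | no δ≮H  = inj₂ (leaf-by-diff v u (off-covers (diff v u) δ′<H (diff-adjacent v u (adj ∘ sym))))
    where
    H<δ : H < diff u v
    H<δ = ≤∧≢⇒< (≮⇒≥ δ≮H) (λ H≡δ → diff-adjacent u v adj (trans (cong (_% M) (sym H≡δ)) H%M≡0))
    δ′<H : diff v u < H
    δ′<H = +-cancelˡ-< H (diff v u) H (begin-strict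
      H + diff v u         <⟨ +-monoˡ-< (diff v u) H<δ ⟩
      diff u v + diff v u  ≡⟨ diff-sum u v adj ⟩
      L * M                ≡⟨ N≡H+H ⟩
      H + H                ∎)
      where open ≤-Reasoning

  unique-star : ∀ {u v t k} → shift (off t k) u ≡ v → ∀ w → EdgeOf (star w) u v → w ≡ (u , t)
  unique-star {u} {t = t} {k} step (c , t′) (inj₁ (refl , k′ , step′)) =
    cong (u ,_) (sym (proj₁ (off-injective
      (shift-injective (trans step (sym step′)) (H<N (off<H t k)) (H<N (off<H t′ k′))))))
  unique-star {t = t} {k} step (c , t′) (inj₂ (refl , k′ , step′)) =
    ⊥-elim (no-mutual-shifts step step′ (off-positive t k) (off<H t k) (off<H t′ k′))

  partition : PartitionsEdges star
  partition u v adj with edge-covered u v adj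
  ... | inj₁ (t , k , step) = (u , t) , inj₁ (refl , k , step) , λ w edge → unique-star step w edge
  ... | inj₂ (t , k , step) = (v , t) , inj₂ (refl , k , step) , λ w edge → unique-star step w (Sum.swap edge)

  rotate-star : ∀ c t → ∀ u v →
    (EdgeOf (star (c , t)) u v → EdgeOf (star (rotate c , t)) (rotate u) (rotate v)) ×
    (EdgeOf (star (rotate c , t)) (rotate u) (rotate v) → EdgeOf (star (c , t)) u v)
  rotate-star c t u v = forward , backward
    where
    forward : EdgeOf (star (c , t)) u v → EdgeOf (star (rotate c , t)) (rotate u) (rotate v)
    forward (inj₁ (u≡c , k , step)) = inj₁ (cong rotate u≡c , k , trans (shift-rotate (off t k) c) (cong rotate step))
    forward (inj₂ (v≡c , k , step)) = inj₂ (cong rotate v≡c , k , trans (shift-rotate (off t k) c) (cong rotate step))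
    backward : EdgeOf (star (rotate c , t)) (rotate u) (rotate v) → EdgeOf (star (c , t)) u v
    backward (inj₁ (u≡c , k , step)) =
      inj₁ (rotate-injective u≡c , k , rotate-injective (trans (sym (shift-rotate (off t k) c)) step))
    backward (inj₂ (v≡c , k , step)) =
      inj₂ (rotate-injective v≡c , k , rotate-injective (trans (sym (shift-rotate (off t k) c)) step))

  decomposition : HasCyclicStarDecomposition e M L
  decomposition = cyclic-decomposition ((M * L) * n) (↔-trans *↔× (*↔× ×-↔ ↔-refl)) star partition
                    ρ ρ-full-cycle (λ { (c , t) → (rotate c , t) , rotate-star c t })

-- With M = q + 1 and H = n·d·M, the numbers z < H
-- with M ∤ z are exactly M·c + (a + 1) for c < n·d and a < q.  Writing
-- c = d·t + s and k = d·a + s (t < n, s < d, k < q·d), class t receives the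
-- q·d offsets indexed by k.
module Offsets (q d n : ℕ) where

  M : ℕ
  M = suc q

  H : ℕ
  H = n * d * M

  offset-of-digits : Fin n → Fin q → Fin d → ℕ
  offset-of-digits t a s = toℕ (combine {n * d} {M} (combine t s) (Fin.suc a))

  offset : Fin n → Fin (q * d) → ℕ
  offset t k = uncurry (offset-of-digits t) (remQuot {q} d k)

  offset<H : ∀ t k → offset t k < H
  offset<H t k = toℕ<n (combine {n * d} {M} _ _)

  -- the residue modulo M of an offset is its last digit a + 1, never 0
  offset-admissible : ∀ t k → offset t k % M ≢ 0
  offset-admissible t k eq
    with trans (sym (toℕ-combine-% (combine t _) (Fin.suc (proj₁ (remQuot {q} d k))))) eq
  ... | ()

  offset-injective : ∀ {t k t′ k′} → offset t k ≡ offset t′ k′ → t ≡ t′ × k ≡ k′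
  offset-injective {t} {k} {t′} {k′} eq = t≡t′ , k≡k′
    where
    open ≡-Reasoning
    a = proj₁ (remQuot {q} d k)
    s = proj₂ (remQuot {q} d k)
    a′ = proj₁ (remQuot {q} d k′)
    s′ = proj₂ (remQuot {q} d k′)
    outer : combine t s ≡ combine t′ s′ × Fin.suc a ≡ Fin.suc a′
    outer = combine-injective _ _ _ _ (toℕ-injective eq)
    inner : t ≡ t′ × s ≡ s′
    inner = combine-injective t s t′ s′ (proj₁ outer)
    t≡t′ : t ≡ t′
    t≡t′ = proj₁ inner
    k≡k′ : k ≡ k′
    k≡k′ = begin
      k             ≡⟨ combine-remQuot {q} d k ⟨
      combine a s   ≡⟨ cong₂ combine (Fin-suc-injective (proj₂ outer)) (proj₂ inner) ⟩
      combine a′ s′ ≡⟨ combine-remQuot {q} d k′ ⟩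
      k′            ∎

  -- read off the digits c, a + 1 of z in base M, then t, s of c in base d
  offset-covers : ∀ z → z < H → z % M ≢ 0 → ∃₂ λ t k → offset t k ≡ z
  offset-covers z z<H z%M≢0 with combine-surjective {n * d} {M} (fromℕ< z<H)
  ... | c , Fin.zero , eq = ⊥-elim (z%M≢0 (begin
    z % M                           ≡⟨ cong (_% M) (toℕ-fromℕ< z<H) ⟨
    toℕ (fromℕ< z<H) % M            ≡⟨ cong (λ x → toℕ x % M) eq ⟨
    toℕ (combine c Fin.zero) % M    ≡⟨ toℕ-combine-% c Fin.zero ⟩
    0                               ∎))
    where open ≡-Reasoning
  ... | c , Fin.suc a , eq with combine-surjective {n} {d} c
  ... | t , s , refl = t , combine a s , (begin
    offset t (combine a s)   ≡⟨ cong (uncurry (offset-of-digits t)) (remQuot-combine a s) ⟩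
    offset-of-digits t a s   ≡⟨ cong toℕ eq ⟩
    toℕ (fromℕ< z<H)         ≡⟨ toℕ-fromℕ< z<H ⟩
    z                        ∎)
    where open ≡-Reasoning

-- The hypotheses
-- n, d ≥ 1 are what make the number of vertices N nonzero.
proposition3p4 : ∀ (e n d : ℕ) → 1 ≤ e → 1 ≤ n → 1 ≤ d → d ∣ e →
    ∀ (q : ℕ) → e ≡ q * d →
    HasCyclicStarDecomposition e (q + 1) (2 * d * n)
proposition3p4 .(q * d) n@(suc _) d@(suc _) _ _ _ _ q refl =
  subst (λ parts → HasCyclicStarDecomposition (q * d) parts (2 * d * n)) (+-comm 1 q)
    (OffsetStars.decomposition M (2 * d * n) H N≡H+H (m*n%n≡0 (n * d) M)
       n (q * d) offset offset<H offset-admissible offset-injective offset-covers)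
  where
  open Offsets q d n
  N≡H+H : 2 * d * n * M ≡ H + H
  N≡H+H = solve 3 (λ d n m → con 2 :* d :* n :* m := n :* d :* m :+ n :* d :* m) refl d n M
    where open +-*-Solver
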